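{- Let $P,Q$ be finite sets of propositional variables, let $M=(W,\prec,\Vdash)$ and $M'=(W',\prec',\Vdash')$ be Kripke models, $w\in W$, $w'\in W'$ and $n\in\omega$. The following are equivalent: (1) $\mathrm{Th}_n^{(P,Q)}(w)\subseteq\mathrm{Th}_n^{(P,Q)}(w')$; (2) $\mathrm{Th}_n^{(Q,P)}(w')\subseteq\mathrm{Th}_n^{(Q,P)}(w)$; (3) $w'\Vdash' C_n^{(P,Q)}(w)$; (4) $w\Vdash C_n^{(Q,P)}(w')$.
   Context: Formulas are built from propositional variables, $\bot$, $\to$, $\Box$. Modal depth: $d(p)=d(\bot)=0$, $d(\varphi\to\psi)=\max\{d(\varphi),d(\psi)\}$, $d(\Box\varphi)=d(\varphi)+1$. Positive/negative variable sets: $v^+(p)=\{p\}$, $v^-(p)=\emptyset$; $v^\pm(\bot)=\emptyset$; $v^+(\psi\to\theta)=v^-(\psi)\cup v^+(\theta)$, $v^-(\psi\to\theta)=v^+(\psi)\cup v^-(\theta)$; $v^\pm(\Box\psi)=v^\pm(\psi)$. A $(P,Q)$-formula is a formula $\varphi$ with $v^+(\varphi)\subseteq P$, $v^-(\varphi)\subseteq Q$. For each $n$ and finite $P,Q$, $F_n^{(P,Q)}$ is a fixed finite set of $(P,Q)$-formulas of depth $\le n$ such that every $(P,Q)$-formula of depth $\le n$ is $\mathbf{K}$-provably equivalent to a member of $F_n^{(P,Q)}$ ($\mathbf{K}$ the least normal modal logic). A Kripke model $(W,\prec,\Vdash)$ has a nonempty set $W$, a binary relation $\prec$ on $W$, and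 a satisfaction relation $\Vdash$ with the usual Boolean clauses and $x\Vdash\Box\varphi$ iff $y\Vdash\varphi$ for all $y$ with $x\prec y$. For $w$ in a model, $\mathrm{Th}_n^{(P,Q)}(w)=\{\varphi\in F_n^{(P,Q)}: w\Vdash\varphi\}$ and $C_n^{(P,Q)}(w)=\bigwedge\mathrm{Th}_n^{(P,Q)}(w)$. -}

module Defs where

open import Data.Nat using (ℕ; zero; suc; _⊔_; _≤_)
open import Data.List using (List; []; _∷_; _++_; filter)
open import Data.List.Membership.Propositional using (_∈_)
open import Data.List.Relation.Unary.All using (All)
open import Data.Product using (Σ; _×_; _,_)
open import Data.Empty using (⊥)
open import Level using (0ℓ)
open import Axiom.ExcludedMiddle using (ExcludedMiddle)
open import Function using (_∘_)

Var : Set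
Var = ℕ

data Fm : Set where
  var  : Var → Fm
  bot  : Fm
  _⇒_  : Fm → Fm → Fm
  □_   : Fm → Fm

infixr 5 _⇒_
infix 6 □_

depth : Fm → ℕ
depth (var p) = 0
depth bot = 0
depth (φ ⇒ ψ) = depth φ ⊔ depth ψ
depth (□ φ) = suc (depth φ)

mutual
  vpos : Fm → List Var
  vpos (var p) = p ∷ []
  vpos bot = []
  vpos (φ ⇒ ψ) = vneg φ ++ vpos ψ
  vpos (□ φ) = vpos φ

  vneg : Fm → List Var
  vneg (var p) = []
  vneg bot = []
  vneg (φ ⇒ ψ) = vpos φ ++ vneg ψ
  vneg (□ φ) = vneg φ

-- (P,Q)-formula: v⁺(φ) ⊆ P and v⁻(φ) ⊆ Q (finite sets given as lists)
IsPQ : List Var → List Var → Fm → Set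
IsPQ P Q φ = All (_∈ P) (vpos φ) × All (_∈ Q) (vneg φ)

¬f_ : Fm → Fm
¬f φ = φ ⇒ bot

⊤f : Fm
⊤f = bot ⇒ bot

_∧f_ : Fm → Fm → Fm
φ ∧f ψ = ¬f (φ ⇒ ¬f ψ)

_⇔f_ : Fm → Fm → Fm
φ ⇔f ψ = (φ ⇒ ψ) ∧f (ψ ⇒ φ)

⋀ : List Fm → Fm
⋀ [] = ⊤f
⋀ (φ ∷ φs) = φ ∧f ⋀ φs

data K⊢_ : Fm → Set where
  ax1  : ∀ φ ψ → K⊢ (φ ⇒ ψ ⇒ φ)
  ax2  : ∀ φ ψ χ → K⊢ ((φ ⇒ ψ ⇒ χ) ⇒ (φ ⇒ ψ) ⇒ φ ⇒ χ)
  ax3  : ∀ φ → K⊢ (¬f ¬f φ ⇒ φ)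
  axK  : ∀ φ ψ → K⊢ (□ (φ ⇒ ψ) ⇒ □ φ ⇒ □ ψ)
  mp   : ∀ {φ ψ} → K⊢ (φ ⇒ ψ) → K⊢ φ → K⊢ ψ
  nec  : ∀ {φ} → K⊢ φ → K⊢ (□ φ)

_≡K_ : Fm → Fm → Set
φ ≡K ψ = K⊢ (φ ⇒ ψ) × K⊢ (ψ ⇒ φ)

-- A choice of the finite sets F_n^{(P,Q)}: F n P Q is a finite list of
-- (P,Q)-formulas of depth ≤ n, and every (P,Q)-formula of depth ≤ n is
-- K-provably equivalent to a member.
record IsNormalFormFamily (F : ℕ → List Var → List Var → List Fm) : Set where
  field
    members-PQ    : ∀ n P Q φ → φ ∈ F n P Q → IsPQ P Q φ
    members-depth : ∀ n P Q φ → φ ∈ F n P Q → depth φ ≤ n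
    complete      : ∀ n P Q φ → IsPQ P Q φ → depth φ ≤ n →
                    Σ Fm (λ ψ → ψ ∈ F n P Q × φ ≡K ψ)

record Model : Set₁ where
  field
    W   : Set
    _≺_ : W → W → Set
    V   : W → Var → Set

  _⊩_ : W → Fm → Set
  x ⊩ var p = V x p
  x ⊩ bot = ⊥
  x ⊩ (φ ⇒ ψ) = x ⊩ φ → x ⊩ ψ
  x ⊩ (□ φ) = ∀ y → x ≺ y → y ⊩ φ

open Model public using (W; _⊩_)

-- Th_n^{(P,Q)}(w) ⊆ Th_n^{(P,Q)}(w')   (both are subsets of F_n^{(P,Q)})
ThSub : (F : ℕ → List Var → List Var → List Fm) → ℕ → List Var → List Var →
        (M : Model) → W M → (M' : Model) → W M' → Set
ThSub F n P Q M w M' w' =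
  ∀ φ → φ ∈ F n P Q → _⊩_ M w φ → _⊩_ M' w' φ

Th : ExcludedMiddle 0ℓ → (F : ℕ → List Var → List Var → List Fm) →
     ℕ → List Var → List Var → (M : Model) → W M → List Fm
Th em F n P Q M w = filter (λ φ → em {_⊩_ M w φ}) (F n P Q)

C : ExcludedMiddle 0ℓ → (F : ℕ → List Var → List Var → List Fm) →
    ℕ → List Var → List Var → (M : Model) → W M → Fm
C em F n P Q M w = ⋀ (Th em F n P Q M w)

-- If φ ∈ F_n^{(Q,P)} fails at w, then ¬φ is a (P,Q)-formula of depth ≤ n, so by
-- soundness of K its representative in F_n^{(P,Q)} holds at w, hence at w' when
-- (1) holds, and refutes φ at w'. This contraposition gives (1) ⇒ (2), and
-- symmetrically (2) ⇒ (1). Since Th_n^{(P,Q)}(w) is finite, w' ⊩ C_n^{(P,Q)}(w)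
-- says exactly that every member of Th_n^{(P,Q)}(w) holds at w', which is (1);
-- likewise (4) is (2).
module Submission where

open import Defs
open import Data.Nat using (ℕ; _≤_)
open import Data.Nat.Properties using (⊔-identityʳ)
open import Data.List using (List; []; _∷_)
open import Data.List.Membership.Propositional using (_∈_)
open import Data.List.Membership.Propositional.Properties using (∈-filter⁺; ∈-filter⁻)
open import Data.List.Relation.Unary.All using ([])
open import Data.List.Relation.Unary.All.Properties using (++⁺)
open import Data.List.Relation.Unary.Any using (here; there)
open import Data.Product using (_×_; _,_; proj₁; proj₂)
open import Data.Empty using (⊥-elim)
open import Relation.Nullary using (yes; no)
open import Relation.Binary.PropositionalEquality using (refl; subst; sym)
open import Level using (0ℓ)
open import Axiom.ExcludedMiddle using (ExcludedMiddle)
open import Axiom.DoubleNegationElimination using (DoubleNegationElimination; em⇒dne)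

IsPQ-¬f : ∀ {P Q} φ → IsPQ Q P φ → IsPQ P Q (¬f φ)
IsPQ-¬f _ (pos , neg) = ++⁺ neg [] , ++⁺ pos []

depth-¬f-≤ : ∀ φ {n} → depth φ ≤ n → depth (¬f φ) ≤ n
depth-¬f-≤ φ {n} = subst (_≤ n) (sym (⊔-identityʳ (depth φ)))

module _ (dne : DoubleNegationElimination 0ℓ) (M : Model) where

  open Model M using () renaming (_⊩_ to _⊩ᴹ_)

  soundness : ∀ {φ} → K⊢ φ → (x : W M) → x ⊩ᴹ φ
  soundness (ax1 φ ψ)   x a _         = a
  soundness (ax2 φ ψ χ) x f g a       = f a (g a)
  soundness (ax3 φ)     x ¬¬a         = dne ¬¬a
  soundness (axK φ ψ)   x f g y x≺y   = f y x≺y (g y x≺y)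
  soundness (mp ⊢φ⇒ψ ⊢φ) x            = soundness ⊢φ⇒ψ x (soundness ⊢φ x)
  soundness (nec ⊢φ)    x y _         = soundness ⊢φ y

  ⊩-∧f⁻ : ∀ {x} φ ψ → x ⊩ᴹ (φ ∧f ψ) → x ⊩ᴹ φ × x ⊩ᴹ ψ
  ⊩-∧f⁻ _ _ x⊩φ∧ψ = dne (λ ¬x⊩φ → x⊩φ∧ψ (λ x⊩φ → ⊥-elim (¬x⊩φ x⊩φ)))
                  , dne (λ ¬x⊩ψ → x⊩φ∧ψ (λ _ x⊩ψ → ¬x⊩ψ x⊩ψ))

  ⊩-⋀⁻ : ∀ {x} (φs : List Fm) → x ⊩ᴹ ⋀ φs → ∀ {φ} → φ ∈ φs → x ⊩ᴹ φ
  ⊩-⋀⁻ (ψ ∷ φs) x⊩⋀ (here refl) = proj₁ (⊩-∧f⁻ ψ (⋀ φs) x⊩⋀)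
  ⊩-⋀⁻ (ψ ∷ φs) x⊩⋀ (there φ∈)  = ⊩-⋀⁻ φs (proj₂ (⊩-∧f⁻ ψ (⋀ φs) x⊩⋀)) φ∈

⊩-⋀⁺ : (M : Model) {x : W M} (φs : List Fm) →
       (∀ {φ} → φ ∈ φs → _⊩_ M x φ) → _⊩_ M x (⋀ φs)
⊩-⋀⁺ M []       _   ()
⊩-⋀⁺ M (φ ∷ φs) all x⊩φ⇒¬⋀ = x⊩φ⇒¬⋀ (all (here refl)) (⊩-⋀⁺ M φs (λ φ∈ → all (there φ∈)))

module _ (em : ExcludedMiddle 0ℓ) (F : ℕ → List Var → List Var → List Fm) where

  ThSub-dual : IsNormalFormFamily F → ∀ {P Q n} (M M' : Model) (w : W M) (w' : W M') →
               ThSub F n P Q M w M' w' → ThSub F n Q P M' w' M w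
  ThSub-dual NF {P} {Q} {n} M M' w w' sub φ φ∈ w'⊩φ with em {_⊩_ M w φ}
  ... | yes w⊩φ = w⊩φ
  ... | no w⊮φ  = ⊥-elim (soundness dne M' ψ⇒¬φ w' (sub ψ ψ∈ w⊩ψ) w'⊩φ)
    where
      open IsNormalFormFamily NF
      dne = em⇒dne em
      normal = complete n P Q (¬f φ) (IsPQ-¬f φ (members-PQ n Q P φ φ∈))
                                      (depth-¬f-≤ φ (members-depth n Q P φ φ∈))
      ψ      = proj₁ normal
      ψ∈     = proj₁ (proj₂ normal)
      ψ⇒¬φ   = proj₂ (proj₂ (proj₂ normal))
      w⊩ψ    = soundness dne M (proj₁ (proj₂ (proj₂ normal))) w w⊮φ

  module _ {n : ℕ} {P Q : List Var} (M : Model) (w : W M) (M' : Model) (w' : W M') where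

    ThSub⇒⊩C : ThSub F n P Q M w M' w' → _⊩_ M' w' (C em F n P Q M w)
    ThSub⇒⊩C sub = ⊩-⋀⁺ M' (Th em F n P Q M w) λ φ∈Th →
      let (φ∈ , w⊩φ) = ∈-filter⁻ (λ φ → em {_⊩_ M w φ}) φ∈Th in sub _ φ∈ w⊩φ

    ⊩C⇒ThSub : _⊩_ M' w' (C em F n P Q M w) → ThSub F n P Q M w M' w'
    ⊩C⇒ThSub w'⊩C φ φ∈ w⊩φ =
      ⊩-⋀⁻ (em⇒dne em) M' (Th em F n P Q M w) w'⊩C (∈-filter⁺ (λ φ → em {_⊩_ M w φ}) φ∈ w⊩φ)

proposition3p4 : (em : ExcludedMiddle 0ℓ) →
    (F : ℕ → List Var → List Var → List Fm) → IsNormalFormFamily F →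
    (P Q : List Var) (M M' : Model) (w : W M) (w' : W M') (n : ℕ) →
    -- (1) ⇔ (2)
    ((ThSub F n P Q M w M' w' → ThSub F n Q P M' w' M w)
      × (ThSub F n Q P M' w' M w → ThSub F n P Q M w M' w'))
    -- (1) ⇔ (3)
    × ((ThSub F n P Q M w M' w' → _⊩_ M' w' (C em F n P Q M w))
      × (_⊩_ M' w' (C em F n P Q M w) → ThSub F n P Q M w M' w'))
    -- (1) ⇔ (4)
    × ((ThSub F n P Q M w M' w' → _⊩_ M w (C em F n Q P M' w'))
      × (_⊩_ M w (C em F n Q P M' w') → ThSub F n P Q M w M' w'))
proposition3p4 em F NF P Q M M' w w' n =
  (1⇒2 , 2⇒1) , (ThSub⇒⊩C em F M w M' w' , ⊩C⇒ThSub em F M w M' w')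
              , (λ sub → ThSub⇒⊩C em F M' w' M w (1⇒2 sub))
              , (λ w⊩C → 2⇒1 (⊩C⇒ThSub em F M' w' M w w⊩C))
  where
    1⇒2 = ThSub-dual em F NF M M' w w'
    2⇒1 = ThSub-dual em F NF M' M w' w
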